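{- For every integer $n \geq 1$, the splitting graph $\mathrm{Spltg}(K_{1,n})$ of the star $K_{1,n}$ admits a signed product cordial labeling, i.e. it is a signed product cordial graph. -}

module Defs where

open import Data.Nat using (ℕ; zero; suc; _+_; _≤_)
open import Data.Fin using (Fin; zero; suc; _↑ˡ_; _↑ʳ_)
open import Data.Bool using (Bool; true; false; _≟_)
open import Data.List using (List; []; _∷_; map; _++_; length; filter; concatMap)
open import Data.Product using (_×_; _,_)
open import Relation.Nullary using (Dec; yes; no; ¬_)
open import Relation.Binary.PropositionalEquality using (_≡_)
open import Data.Vec.Functional using (Vector)
open import Data.List using (allFin)

-- A finite (simple, undirected) graph: vertex set Fin order, each undirected
-- edge listed exactly once as an (unordered) pair of endpoints.
record Graph : Set where
  field
    order : ℕ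
    edges : List (Fin order × Fin order)
open Graph public

star : ℕ → Graph
star n = record
  { order = suc n
  ; edges = map (λ i → (zero , suc i)) (allFin n) }

-- Splitting graph Spltg(G): for each vertex v add a new vertex v' adjacent to
-- every neighbour of v.  Vertices: old v ↦ v ↑ˡ order, new v' ↦ order ↑ʳ v.
spltg : Graph → Graph
spltg G = record
  { order = order G + order G
  ; edges = concatMap step (edges G) }
  where
  N = order G
  step : Fin N × Fin N → List (Fin (N + N) × Fin (N + N))
  step (u , w) = (u ↑ˡ N , w ↑ˡ N) ∷ (N ↑ʳ u , w ↑ˡ N) ∷ (u ↑ˡ N , N ↑ʳ w) ∷ []

-- Signed labels: true represents +1, false represents -1.
-- Induced edge label f(u)·f(v): +1 iff both endpoint labels agree.
edgeLabel : {V : ℕ} → (Fin V → Bool) → Fin V × Fin V → Bool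
edgeLabel f (u , w) with f u ≟ f w
... | yes _ = true
... | no _ = false

countList : {A : Set} → (A → Bool) → Bool → List A → ℕ
countList g b [] = 0
countList g b (x ∷ xs) with g x ≟ b
... | yes _ = suc (countList g b xs)
... | no _ = countList g b xs

vcount : (G : Graph) → (Fin (order G) → Bool) → Bool → ℕ
vcount G f b = countList f b (allFin (order G))

ecount : (G : Graph) → (Fin (order G) → Bool) → Bool → ℕ
ecount G f b = countList (edgeLabel f) b (edges G)

Balanced : ℕ → ℕ → Set
Balanced a b = (a ≤ suc b) × (b ≤ suc a)

IsSignedProductCordialLabeling : (G : Graph) → (Fin (order G) → Bool) → Set
IsSignedProductCordialLabeling G f =
  Balanced (vcount G f false) (vcount G f true) ×
  Balanced (ecount G f false) (ecount G f true)

SignedProductCordial : Graph → Set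
SignedProductCordial G = Data.Product.Σ (Fin (order G) → Bool) (IsSignedProductCordialLabeling G)

{-# OPTIONS --safe #-}
-- Give every new vertex v′ of Spltg(G) the label opposite to that of v; then each label
-- occurs on exactly |V(G)| vertices.  An edge uw of G yields the edges uw, u′w and uw′,
-- and the last two carry the label opposite to that of uw.  So each label b occurs on
-- |E(G)| + e_G(−b) edges, and Spltg(G) is signed product cordial as soon as some labeling
-- of G has balanced edge labels.  For K_{1,n}, labeling the centre +1 and the leaves
-- alternately makes the edge labels alternate.
module Submission where

open import Defs
open import Data.Bool using (Bool; true; false; not; _≟_)
open import Data.Bool.Properties using (not-involutive; not-¬; ¬-not)
open import Data.Fin using (Fin; zero; suc; _↑ˡ_; _↑ʳ_; splitAt)
open import Data.Fin.Properties using (splitAt-↑ˡ; splitAt-↑ʳ)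
open import Data.List using (List; []; _∷_; _++_; map; length; tabulate; allFin)
open import Data.List.Properties using (length-tabulate; map-tabulate)
open import Data.Nat as ℕ using (ℕ; zero; suc; _+_; _≥_; ⌊_/2⌋; ⌈_/2⌉)
open import Data.Nat.Properties
  using ( +-suc; +-monoʳ-≤; n≤1+n; m≤n⇒m≤1+n; ⌊n/2⌋≤⌈n/2⌉; ⌈n/2⌉-mono
        ; +-commutativeSemigroup)
open import Algebra.Properties.CommutativeSemigroup +-commutativeSemigroup using (x∙yz≈y∙xz)
open import Data.Product using (_×_; _,_; swap)
open import Data.Sum using ([_,_])
open import Function using (_∘_; id)
open import Relation.Nullary using (does; yes; no; contradiction)
open import Relation.Binary.PropositionalEquality
  using (_≡_; refl; sym; trans; cong; cong₂; subst; subst₂; module ≡-Reasoning)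

open ≡-Reasoning

module _ {A : Set} where

  countList-++ : ∀ (g : A → Bool) b xs ys →
                 countList g b (xs ++ ys) ≡ countList g b xs + countList g b ys
  countList-++ g b []       ys = refl
  countList-++ g b (x ∷ xs) ys with g x ≟ b
  ... | yes _ = cong suc (countList-++ g b xs ys)
  ... | no  _ = countList-++ g b xs ys

  countList-map : ∀ {B : Set} (g : A → Bool) (h : B → A) b xs →
                  countList g b (map h xs) ≡ countList (g ∘ h) b xs
  countList-map g h b []       = refl
  countList-map g h b (x ∷ xs) with g (h x) ≟ b
  ... | yes _ = cong suc (countList-map g h b xs)
  ... | no  _ = countList-map g h b xs

  countList-resp : ∀ {g k : A → Bool} {b c} →
                   (∀ x → g x ≡ b → k x ≡ c) → (∀ x → k x ≡ c → g x ≡ b) →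
                   ∀ xs → countList g b xs ≡ countList k c xs
  countList-resp to from [] = refl
  countList-resp {g} {k} {b} {c} to from (x ∷ xs) with g x ≟ b | k x ≟ c
  ... | yes _    | yes _    = cong suc (countList-resp to from xs)
  ... | no  _    | no  _    = countList-resp to from xs
  ... | yes gx≡b | no  kx≢c = contradiction (to x gx≡b) kx≢c
  ... | no  gx≢b | yes kx≡c = contradiction (from x kx≡c) gx≢b

  countList-cong : ∀ {g k : A → Bool} → (∀ x → g x ≡ k x) → ∀ b xs →
                   countList g b xs ≡ countList k b xs
  countList-cong g≗k b = countList-resp (λ x → trans (sym (g≗k x))) (λ x → trans (g≗k x))

  countList-not : ∀ (g : A → Bool) b xs →
                  countList (not ∘ g) b xs ≡ countList g (not b) xs
  countList-not g b = countList-resp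
    (λ x ¬gx≡b → trans (sym (not-involutive (g x))) (cong not ¬gx≡b))
    (λ x gx≡¬b → trans (cong not gx≡¬b) (not-involutive b))

  countList-+-not : ∀ (g : A → Bool) b xs →
                    countList g b xs + countList g (not b) xs ≡ length xs
  countList-+-not g b [] = refl
  countList-+-not g b (x ∷ xs) with g x ≟ b | g x ≟ not b
  ... | yes gx≡b | yes gx≡¬b = contradiction gx≡¬b (not-¬ gx≡b)
  ... | yes _    | no  _     = cong suc (countList-+-not g b xs)
  ... | no  _    | yes _     = trans (+-suc _ _) (cong suc (countList-+-not g b xs))
  ... | no  gx≢b | no  gx≢¬b = contradiction (¬-not gx≢b) gx≢¬b

  tabulate-+ : ∀ m n (f : Fin (m + n) → A) →
               tabulate f ≡ tabulate (f ∘ (_↑ˡ n)) ++ tabulate (f ∘ (m ↑ʳ_))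
  tabulate-+ zero    n f = refl
  tabulate-+ (suc m) n f = cong (f zero ∷_) (tabulate-+ m n (f ∘ suc))

countList-allFin-map : ∀ {A : Set} {n} (g : A → Bool) (h : Fin n → A) b →
                       countList g b (tabulate h) ≡ countList (g ∘ h) b (allFin n)
countList-allFin-map g h b = trans (cong (countList g b) (sym (map-tabulate id h)))
                                   (countList-map g h b (allFin _))

Balanced-sym : ∀ {a b} → Balanced a b → Balanced b a
Balanced-sym = swap

+-Balanced : ∀ k {a b} → Balanced a b → Balanced (k + a) (k + b)
+-Balanced k {a} {b} (a≤1+b , b≤1+a) =
  subst (k + a ℕ.≤_) (+-suc k b) (+-monoʳ-≤ k a≤1+b) ,
  subst (k + b ℕ.≤_) (+-suc k a) (+-monoʳ-≤ k b≤1+a)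

⌊n/2⌋-⌈n/2⌉-Balanced : ∀ n → Balanced ⌊ n /2⌋ ⌈ n /2⌉
⌊n/2⌋-⌈n/2⌉-Balanced n = m≤n⇒m≤1+n (⌊n/2⌋≤⌈n/2⌉ n) , ⌈n/2⌉-mono (n≤1+n n)

sameLabel : Bool → Bool → Bool
sameLabel a c = does (a ≟ c)

edgeLabel-sameLabel : ∀ {V} (f : Fin V → Bool) x y →
                      edgeLabel f (x , y) ≡ sameLabel (f x) (f y)
edgeLabel-sameLabel f x y with f x ≟ f y
... | yes _ = refl
... | no  _ = refl

countList-twinLabels : ∀ a c b →
  countList id b (sameLabel a c ∷ sameLabel (not a) c ∷ sameLabel a (not c) ∷ [])
    ≡ suc (countList id (not b) (sameLabel a c ∷ []))
countList-twinLabels true  true  true  = refl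
countList-twinLabels true  true  false = refl
countList-twinLabels true  false true  = refl
countList-twinLabels true  false false = refl
countList-twinLabels false true  true  = refl
countList-twinLabels false true  false = refl
countList-twinLabels false false true  = refl
countList-twinLabels false false false = refl

module TwinComplement (G : Graph) {g : Fin (order G) → Bool}
                      (f : Fin (order G + order G) → Bool)
                      (f-old : ∀ u → f (u ↑ˡ order G) ≡ g u)
                      (f-new : ∀ u → f (order G ↑ʳ u) ≡ not (g u)) where

  private
    N : ℕ
    N = order G

    old new : Fin N → Fin (N + N)
    old u = u ↑ˡ N
    new u = N ↑ʳ u

  twinEdges : Fin N → Fin N → List (Fin (N + N) × Fin (N + N))
  twinEdges u w = (old u , old w) ∷ (new u , old w) ∷ (old u , new w) ∷ []

  vcount-spltg : ∀ b → vcount (spltg G) f b ≡ N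
  vcount-spltg b = begin
    countList f b (allFin (N + N))
      ≡⟨ cong (countList f b) (tabulate-+ N N id) ⟩
    countList f b (tabulate old ++ tabulate new)
      ≡⟨ countList-++ f b (tabulate old) (tabulate new) ⟩
    countList f b (tabulate old) + countList f b (tabulate new)
      ≡⟨ cong₂ _+_ (trans (countList-allFin-map f old b) (countList-cong f-old b (allFin N)))
                   (trans (countList-allFin-map f new b) (countList-cong f-new b (allFin N))) ⟩
    countList g b (allFin N) + countList (not ∘ g) b (allFin N)
      ≡⟨ cong (countList g b (allFin N) +_) (countList-not g b (allFin N)) ⟩
    countList g b (allFin N) + countList g (not b) (allFin N)
      ≡⟨ countList-+-not g b (allFin N) ⟩
    length (allFin N)
      ≡⟨ length-tabulate id ⟩
    N ∎

  countList-twinEdges : ∀ b u w → countList (edgeLabel f) b (twinEdges u w)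
                                   ≡ suc (countList (edgeLabel g) (not b) ((u , w) ∷ []))
  countList-twinEdges b u w = begin
    countList (edgeLabel f) b (twinEdges u w)
      ≡⟨ sym (countList-map id (edgeLabel f) b (twinEdges u w)) ⟩
    countList id b (map (edgeLabel f) (twinEdges u w))
      ≡⟨ cong (countList id b) twinLabels ⟩
    countList id b labels
      ≡⟨ countList-twinLabels (g u) (g w) b ⟩
    suc (countList id (not b) (sameLabel (g u) (g w) ∷ []))
      ≡⟨ cong (λ l → suc (countList id (not b) (l ∷ []))) (sym (edgeLabel-sameLabel g u w)) ⟩
    suc (countList id (not b) (map (edgeLabel g) ((u , w) ∷ [])))
      ≡⟨ cong suc (countList-map id (edgeLabel g) (not b) _) ⟩
    suc (countList (edgeLabel g) (not b) ((u , w) ∷ [])) ∎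
    where
    labels : List Bool
    labels = sameLabel (g u) (g w) ∷ sameLabel (not (g u)) (g w) ∷ sameLabel (g u) (not (g w)) ∷ []
    label : ∀ {x y a c} → f x ≡ a → f y ≡ c → edgeLabel f (x , y) ≡ sameLabel a c
    label fx≡a fy≡c = trans (edgeLabel-sameLabel f _ _) (cong₂ sameLabel fx≡a fy≡c)
    twinLabels : map (edgeLabel f) (twinEdges u w) ≡ labels
    twinLabels = cong₂ _∷_ (label (f-old u) (f-old w))
                (cong₂ _∷_ (label (f-new u) (f-old w))
                (cong₂ _∷_ (label (f-old u) (f-new w)) refl))

  ecount-spltg : ∀ b → ecount (spltg G) f b ≡ length (edges G) + ecount G g (not b)
  ecount-spltg b = go (edges G)
    where
    count : List (Fin N × Fin N) → ℕ
    count = countList (edgeLabel g) (not b)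
    go : ∀ es → ecount (spltg (record G { edges = es })) f b
                  ≡ length es + ecount (record G { edges = es }) g (not b)
    go []             = refl
    go ((u , w) ∷ es) = begin
      countList (edgeLabel f) b (twinEdges u w ++ rest)
        ≡⟨ countList-++ (edgeLabel f) b (twinEdges u w) rest ⟩
      countList (edgeLabel f) b (twinEdges u w) + countList (edgeLabel f) b rest
        ≡⟨ cong₂ _+_ (countList-twinEdges b u w) (go es) ⟩
      suc (count uw + (length es + count es))
        ≡⟨ cong ℕ.suc (x∙yz≈y∙xz (count uw) (length es) (count es)) ⟩
      suc (length es + (count uw + count es))
        ≡⟨ cong (ℕ.suc ∘ (length es +_)) (sym (countList-++ (edgeLabel g) (not b) uw es)) ⟩
      suc (length es) + count ((u , w) ∷ es) ∎
      where
      uw : List (Fin N × Fin N)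
      uw = (u , w) ∷ []
      rest : List (Fin (N + N) × Fin (N + N))
      rest = edges (spltg (record G { edges = es }))

twinComplement : ∀ {N} → (Fin N → Bool) → Fin (N + N) → Bool
twinComplement {N} g x = [ g , not ∘ g ] (splitAt N x)

spltg-signedProductCordial : ∀ G (g : Fin (order G) → Bool) →
                             Balanced (ecount G g false) (ecount G g true) →
                             SignedProductCordial (spltg G)
spltg-signedProductCordial G g balanced =
  twinComplement g ,
  subst₂ Balanced (sym (vcount-spltg false)) (sym (vcount-spltg true)) (n≤1+n N , n≤1+n N) ,
  subst₂ Balanced (sym (ecount-spltg false)) (sym (ecount-spltg true))
         (+-Balanced (length (edges G)) (Balanced-sym balanced))
  where
  N = order G
  f-old : ∀ u → twinComplement g (u ↑ˡ N) ≡ g u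
  f-old u = cong [ g , not ∘ g ] (splitAt-↑ˡ N u N)
  f-new : ∀ u → twinComplement g (N ↑ʳ u) ≡ not (g u)
  f-new u = cong [ g , not ∘ g ] (splitAt-↑ʳ N N u)
  open TwinComplement G (twinComplement g) f-old f-new

alternating : ∀ {n} → Fin n → Bool
alternating zero    = true
alternating (suc i) = not (alternating i)

countList-alternating : ∀ n → countList alternating true  (allFin n) ≡ ⌈ n /2⌉
                            × countList alternating false (allFin n) ≡ ⌊ n /2⌋
countList-alternating zero    = refl , refl
countList-alternating (suc n) with countList-alternating n
... | trues , falses = cong suc (trans (shift true) falses) , trans (shift false) trues
  where
  shift : ∀ b → countList alternating b (tabulate {n = n} suc)
                ≡ countList alternating (not b) (allFin n)
  shift b = trans (countList-allFin-map (alternating {suc n}) suc b)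
                  (countList-not (alternating {n}) b (allFin n))

starLabel : ∀ n → Fin (suc n) → Bool
starLabel n zero    = true
starLabel n (suc i) = alternating i

ecount-star : ∀ n b → ecount (star n) (starLabel n) b ≡ countList alternating b (allFin n)
ecount-star n b = trans (countList-map (edgeLabel (starLabel n)) (λ i → zero , suc i) b (allFin n))
                        (countList-cong leafEdgeLabel b (allFin n))
  where
  sameLabel-true : ∀ a → sameLabel true a ≡ a
  sameLabel-true true  = refl
  sameLabel-true false = refl
  leafEdgeLabel : ∀ i → edgeLabel (starLabel n) (zero , suc i) ≡ alternating i
  leafEdgeLabel i = trans (edgeLabel-sameLabel (starLabel n) zero (suc i))
                          (sameLabel-true (alternating i))

starLabel-edgesBalanced : ∀ n → Balanced (ecount (star n) (starLabel n) false)
                                         (ecount (star n) (starLabel n) true)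
starLabel-edgesBalanced n with countList-alternating n
... | trues , falses = subst₂ Balanced (sym (trans (ecount-star n false) falses))
                                       (sym (trans (ecount-star n true) trues))
                                       (⌊n/2⌋-⌈n/2⌉-Balanced n)

theorem2p1 : (n : ℕ) → n ≥ 1 → SignedProductCordial (spltg (star n))
theorem2p1 n _ = spltg-signedProductCordial (star n) (starLabel n) (starLabel-edgesBalanced n)
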